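{- In the folding setting described in the context, fix $i'\in I$ and $j'\in O_{i'}$. Let $v\lessdot w=vs_\alpha$ be a Bruhat cover in $W_A$ with $\alpha\in\Delta_{re}^+(\mathfrak{g}(A))$, and let $O\subset\Delta_{re}^+(\mathfrak{g}(B))$ be its associated orbit. Then $$m^A_{\Lambda_{i'}}(v,w)=\sum_{\gamma\in O}m^B_{\omega_{j'}}(f(w)s_\gamma,f(w))=\sum_{\gamma\in O}m^B_{\omega_{j'}}(f(v),f(v)s_\gamma),$$ i.e. the number of marked edges $v\to w$ in $\Gamma_s^A(\Lambda_{i'})$ equals the number of marked edges of $\Gamma_s^B(\omega_{j'})$ going into $f(w)$ within the interval $[f(v),f(w)]$, which equals the number of marked edges of $\Gamma_s^B(\omega_{j'})$ coming out of $f(v)$ within $[f(v),f(w)]$.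
   Context: Let $B=(b_{jk})_{j,k\in J}$ be a generalized Cartan matrix (GCM) and $\pi$ a permutation of $J$ with $b_{\pi(j)\pi(k)}=b_{jk}$, admissible: $b_{jk}=0$ for $j,k$ in the same $\pi$-orbit. Let $I$ index the $\pi$-orbits, $O_i$ the orbit indexed by $i$, $o_i=|O_i|$, and $A$ the GCM with $a_{i'i}=\frac{o_{i'}}{o_i}\sum_{j\in O_i}b_{j'j}$ for any $j'\in O_{i'}$. For $\mathfrak{g}(A)$: simple roots $\alpha_i$, coroots $\alpha_i^\vee$, fundamental weights $\Lambda_i$, Weyl group $W_A$; for $\mathfrak{g}(B)$: $\beta_j,\beta_j^\vee,\omega_j,W_B$. For a real positive root $\gamma=u\beta_j$, $\gamma^\vee=u\beta_j^\vee$ and $s_\gamma=us_ju^{ -1}$ (similarly for $A$). Bruhat covers: $x\lessdot xs_\gamma$ with $\ell(xs_\gamma)=\ell(x)+1$. For a dominant integral weight $\Lambda$, $m_\Lambda(x,xs_\gamma)=\langle\gamma^\vee,\Lambda\rangle$ is the multiplicity of the edge $x\to xs_\gamma$ in the strong graph $\Gamma_s(\Lambda)$ (vertex set the Weyl group, one edge per Bruhat cover); superscripts $A,B$ indicate the algebra. $\pi$ acts on $\Delta_{re}^+(\mathfrak{g}(B))$ via $\beta_j\mapsto\beta_{\pi(j)}$. $f:W_A\to W_B$ is the injective homomorphism $f(s_i^A)=\prod_{j\in O_i}s_j^B$. For a cover $v\lessdot w=vs_\alpha$ in $W_A$, its associated orbit is the unique $\pi$-orbit $O\subset\Delta_{re}^+(\mathfrak{g}(B))$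 such that the $s_\gamma$ ($\gamma\in O$) pairwise commute, $f(s_\alpha)=\prod_{\gamma\in O}s_\gamma$, and $O'\mapsto f(v)\prod_{\gamma\in O'}s_\gamma$ is an isomorphism of the Boolean lattice of subsets of $O$ onto the Bruhat interval $[f(v),f(w)]$ (explicitly $O=\{f(u)\beta_j\mid j\in O_i\}$ where $\alpha=u\alpha_i$ with $w=u_1s_iu^{ -1}$ length-additive and $v=u_1u^{ -1}$). -}

module Defs where

open import Data.Nat as ℕ using (ℕ; zero; suc)
open import Data.Integer using (ℤ; 0ℤ; 1ℤ; +_; _-_; _*_; _+_; _≤_)
open import Data.Fin using (Fin; zero; suc; _≟_)
open import Data.Fin.Permutation using (Permutation′; _⟨$⟩ʳ_)
open import Data.List using (List; []; _∷_; _++_; reverse; length; concatMap; filter; allFin)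
open import Data.Bool using (if_then_else_)
open import Data.Product using (Σ; ∃; _×_)
open import Function using (_∘_)
open import Function.Bundles using (_⇔_)
open import Relation.Nullary using (¬_)
open import Relation.Nullary.Decidable using (⌊_⌋)
open import Relation.Binary.PropositionalEquality using (_≡_)

sumℤ : ∀ {n} → (Fin n → ℤ) → ℤ
sumℤ {zero}  f = 0ℤ
sumℤ {suc n} f = f zero + sumℤ (f ∘ suc)

Matrix : ℕ → Set
Matrix n = Fin n → Fin n → ℤ

record IsGCM {n : ℕ} (a : Matrix n) : Set where
  field
    diag    : ∀ i → a i i ≡ + 2
    offdiag : ∀ i j → ¬ (i ≡ j) → a i j ≤ 0ℤ
    zero-sym : ∀ i j → a i j ≡ 0ℤ → a j i ≡ 0ℤ

Vec : ℕ → Set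
Vec n = Fin n → ℤ

e : ∀ {n} → Fin n → Vec n
e i k = if ⌊ k ≟ i ⌋ then 1ℤ else 0ℤ

-- Simple reflection s_i on the root lattice (basis: simple roots α_k):
-- s_i(λ) = λ - ⟨α_i^∨, λ⟩ α_i, with ⟨α_i^∨, α_l⟩ = a_{il}.
sR : ∀ {n} → Matrix n → Fin n → Vec n → Vec n
sR a i r k = if ⌊ k ≟ i ⌋ then r k - sumℤ (λ l → a i l * r l) else r k

-- Simple reflection s_i on the coroot lattice (basis: simple coroots α_k^∨):
-- s_i(h) = h - ⟨h, α_i⟩ α_i^∨, with ⟨α_l^∨, α_i⟩ = a_{li}.
sC : ∀ {n} → Matrix n → Fin n → Vec n → Vec n
sC a i h k = if ⌊ k ≟ i ⌋ then h k - sumℤ (λ l → h l * a l i) else h k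

-- Words in the simple reflections; [i₁,…,i_k] stands for s_{i₁}⋯s_{i_k}.
Word : ℕ → Set
Word n = List (Fin n)

actR : ∀ {n} → Matrix n → Word n → Vec n → Vec n
actR a []      r = r
actR a (i ∷ w) r = sR a i (actR a w r)

actC : ∀ {n} → Matrix n → Word n → Vec n → Vec n
actC a []      h = h
actC a (i ∷ w) h = sC a i (actC a w h)

-- Equality in the Weyl group W(a): equal action on the root lattice
-- (this action is faithful).
_≈[_]_ : ∀ {n} → Word n → Matrix n → Word n → Set
w ≈[ a ] w' = ∀ r k → actR a w r k ≡ actR a w' r k

IsLength : ∀ {n} → Matrix n → Word n → ℕ → Set
IsLength a w k =
  (Σ (Word _) λ x → length x ≡ k × x ≈[ a ] w) ×
  (∀ x → x ≈[ a ] w → k ℕ.≤ length x)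

-- Real root γ = u α_i, its coroot γ^∨ = u α_i^∨, and s_γ = u s_i u⁻¹.
root : ∀ {n} → Matrix n → Word n → Fin n → Vec n
root a u i = actR a u (e i)

coroot : ∀ {n} → Matrix n → Word n → Fin n → Vec n
coroot a u i = actC a u (e i)

reflection : ∀ {n} → Word n → Fin n → Word n
reflection u i = u ++ i ∷ reverse u

IsPositive : ∀ {n} → Vec n → Set
IsPositive v = ∀ k → 0ℤ ≤ v k

BruhatCover : ∀ {n} → Matrix n → Word n → Word n → Word n → Fin n → Set
BruhatCover a x y u i =
  IsPositive (root a u i) × y ≈[ a ] (x ++ reflection u i) ×
  Σ ℕ λ k → IsLength a x k × IsLength a y (suc k)

-- Edge multiplicity m_{Λ_k}(x, x s_γ) = ⟨γ^∨, Λ_k⟩ for γ = u α_i: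
-- the α_k^∨-coordinate of γ^∨.  (Depends only on γ; x, y are the edge.)
mult : ∀ {n} → Matrix n → Fin n → Word n → Word n → Word n → Fin n → ℤ
mult a k x y u i = coroot a u i k

iter : ∀ {n} → ℕ → Permutation′ n → Fin n → Fin n
iter zero    π j = j
iter (suc t) π j = π ⟨$⟩ʳ (iter t π j)

orbitList : ∀ {n m} → (Fin n → Fin m) → Fin m → List (Fin n)
orbitList {n} orb i = filter (λ j → orb j ≟ i) (allFin n)

orbitSize : ∀ {n m} → (Fin n → Fin m) → Fin m → ℕ
orbitSize orb i = length (orbitList orb i)

sumOrbit : ∀ {n m} → (Fin n → Fin m) → Fin m → (Fin n → ℤ) → ℤ
sumOrbit orb i g = sumℤ (λ j → if ⌊ orb j ≟ i ⌋ then g j else 0ℤ)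

-- f : W_A → W_B on words, f(s_i) = ∏_{j ∈ O_i} s_j.
fW : ∀ {n m} → (Fin n → Fin m) → Word m → Word n
fW orb = concatMap (orbitList orb)

record Folding (n m : ℕ) : Set where
  field
    B        : Matrix n
    B-gcm    : IsGCM B
    π        : Permutation′ n
    π-inv    : ∀ j k → B (π ⟨$⟩ʳ j) (π ⟨$⟩ʳ k) ≡ B j k
    orb      : Fin n → Fin m      -- j ↦ index of its π-orbit
    orb-surj : ∀ i → ∃ λ j → orb j ≡ i
    orb-char : ∀ j k → (orb j ≡ orb k) ⇔ (∃ λ t → iter t π j ≡ k)
    admissible : ∀ j k → orb j ≡ orb k → ¬ (j ≡ k) → B j k ≡ 0ℤ
    A        : Matrix m
    A-def    : ∀ i' i j' → orb j' ≡ i' →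
               + orbitSize orb i * A i' i ≡ + orbitSize orb i' * sumOrbit orb i (B j')

{-# OPTIONS --safe #-}
module Submission where

-- Let φ h = h ∘ orb send the coroot lattice of A into that of B, so that φ αᵢ^∨ = Σ_{j∈Oᵢ} βⱼ^∨.
-- Admissibility makes the reflections sⱼ (j ∈ Oᵢ) mutually orthogonal, so their product f(sᵢ)
-- subtracts ⟨y, βₖ⟩ from the βₖ^∨-coordinate of y for each k ∈ Oᵢ.  For y = φ h this pairing
-- equals ⟨h, αᵢ⟩: the sum of a column of B over an orbit is an entry of A, which follows from
-- A-def by double counting, since π-invariance makes orbit sums along rows and columns of B
-- constant on orbits.  Hence φ ∘ u = f(u) ∘ φ, and φ (u αᵢ^∨) = Σ_{j∈Oᵢ} f(u) βⱼ^∨.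

open import Defs
open import Data.Nat as ℕ using (ℕ; zero; suc; >-nonZero)
open import Data.Integer using (ℤ; 0ℤ; +_; _-_; _*_)
import Data.Integer.Properties as ℤ
open import Data.Bool using (Bool; true; false; if_then_else_)
open import Data.Bool.Properties using (if-swap-then)
open import Data.Fin using (Fin; zero; suc; _≟_)
open import Data.Fin.Permutation using (Permutation′; _⟨$⟩ʳ_)
open import Data.List using (List; []; _∷_; _++_; reverse; length; filter; tabulate; allFin)
open import Data.List.Membership.Propositional using (_∈_; _∉_)
open import Data.List.Membership.Propositional.Properties using (∈-filter⁺; ∈-filter⁻; ∈-allFin; ∈-length)
open import Data.List.Relation.Unary.Any using (here; there; any?)
open import Data.List.Relation.Unary.All.Properties using (All¬⇒¬Any)
open import Data.List.Relation.Unary.AllPairs using (_∷_)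
open import Data.List.Relation.Unary.Unique.Propositional using (Unique)
open import Data.List.Relation.Unary.Unique.Propositional.Properties using (filter⁺; allFin⁺)
open import Data.Product using (Σ; _×_; _,_; proj₂)
open import Function.Bundles using (Equivalence)
open import Function using (_∘_; id)
open import Relation.Nullary using (yes; no; contradiction)
open import Relation.Nullary.Decidable using (⌊_⌋)
open import Relation.Unary using (Pred; Decidable)
open import Relation.Binary.PropositionalEquality
open import Algebra.Properties.CommutativeSemigroup ℤ.+-commutativeSemigroup
  using () renaming (interchange to +-interchange)
open import Algebra.Properties.Semiring.Sum ℤ.+-*-semiring using (sum; sum-permute)

-- ℤ addition is opened only inside modules, since the final statement uses ℕ's _+_.
module Sums where
  open import Data.Integer using (_+_)

  sumℤ≡sum : ∀ {n} (f : Fin n → ℤ) → sumℤ f ≡ sum f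
  sumℤ≡sum {zero}  f = refl
  sumℤ≡sum {suc n} f = cong (_+_ (f zero)) (sumℤ≡sum (f ∘ suc))

  sumℤ-cong : ∀ {n} {f g : Fin n → ℤ} → f ≗ g → sumℤ f ≡ sumℤ g
  sumℤ-cong {zero}  f≗g = refl
  sumℤ-cong {suc n} f≗g = cong₂ _+_ (f≗g zero) (sumℤ-cong (f≗g ∘ suc))

  sumℤ-zero : ∀ n → sumℤ {n} (λ _ → 0ℤ) ≡ 0ℤ
  sumℤ-zero zero    = refl
  sumℤ-zero (suc n) = trans (ℤ.+-identityˡ _) (sumℤ-zero n)

  sumℤ-+ : ∀ {n} (f g : Fin n → ℤ) → sumℤ (λ j → f j + g j) ≡ sumℤ f + sumℤ g
  sumℤ-+ {zero}  f g = refl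
  sumℤ-+ {suc n} f g = trans (cong (_+_ (f zero + g zero)) (sumℤ-+ (f ∘ suc) (g ∘ suc)))
    (+-interchange (f zero) (g zero) _ _)

  sumℤ-*ˡ : ∀ {n} (c : ℤ) (f : Fin n → ℤ) → sumℤ (λ j → c * f j) ≡ c * sumℤ f
  sumℤ-*ˡ {zero}  c f = sym (ℤ.*-zeroʳ c)
  sumℤ-*ˡ {suc n} c f =
    trans (cong (_+_ (c * f zero)) (sumℤ-*ˡ c (f ∘ suc))) (sym (ℤ.*-distribˡ-+ c (f zero) _))

  sumℤ-comm : ∀ {m n} (f : Fin m → Fin n → ℤ) →
              sumℤ (λ i → sumℤ (f i)) ≡ sumℤ (λ j → sumℤ (λ i → f i j))
  sumℤ-comm {zero}  {n} f = sym (sumℤ-zero n)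
  sumℤ-comm {suc m} {n} f =
    trans (cong (_+_ (sumℤ (f zero))) (sumℤ-comm (f ∘ suc))) (sym (sumℤ-+ (f zero) _))

  sumℤ-permute : ∀ {n} (f : Fin n → ℤ) (π : Permutation′ n) → sumℤ f ≡ sumℤ (f ∘ (π ⟨$⟩ʳ_))
  sumℤ-permute f π = begin
    sumℤ f                 ≡⟨ sumℤ≡sum f ⟩
    sum f                  ≡⟨ sum-permute f π ⟩
    sum (f ∘ (π ⟨$⟩ʳ_))    ≡⟨ sumℤ≡sum (f ∘ (π ⟨$⟩ʳ_)) ⟨
    sumℤ (f ∘ (π ⟨$⟩ʳ_))   ∎
    where open ≡-Reasoning

  sumℤ-δ : ∀ {n} (k : Fin n) (g : Fin n → ℤ) → sumℤ (λ j → if ⌊ k ≟ j ⌋ then g j else 0ℤ) ≡ g k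
  sumℤ-δ {suc n} zero    g = trans (cong (_+_ (g zero)) (sumℤ-zero n)) (ℤ.+-identityʳ (g zero))
  sumℤ-δ {suc n} (suc k) g = begin
    0ℤ + sumℤ (λ j → if ⌊ suc k ≟ suc j ⌋ then g (suc j) else 0ℤ)
      ≡⟨ ℤ.+-identityˡ _ ⟩
    sumℤ (λ j → if ⌊ suc k ≟ suc j ⌋ then g (suc j) else 0ℤ)
      ≡⟨ sumℤ-cong (λ j → cong (λ b → if b then g (suc j) else 0ℤ) (⌊suc≟suc⌋ j)) ⟩
    sumℤ (λ j → if ⌊ k ≟ j ⌋ then g (suc j) else 0ℤ)
      ≡⟨ sumℤ-δ k (g ∘ suc) ⟩
    g (suc k) ∎
    where
    open ≡-Reasoning
    ⌊suc≟suc⌋ : ∀ j → ⌊ suc k ≟ suc j ⌋ ≡ ⌊ k ≟ j ⌋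
    ⌊suc≟suc⌋ j with k ≟ j
    ... | yes _ = refl
    ... | no _  = refl

  sumℤ-if : ∀ {n} b (f : Fin n → ℤ) → (if b then sumℤ f else 0ℤ) ≡ sumℤ (λ j → if b then f j else 0ℤ)
  sumℤ-if true  f = refl
  sumℤ-if {n} false f = sym (sumℤ-zero n)

  sumℤ-count : ∀ {a p} {A : Set a} {P : Pred A p} (P? : Decidable P) {n} (t : Fin n → A) x →
               sumℤ (λ j → if ⌊ P? (t j) ⌋ then x else 0ℤ) ≡ + length (filter P? (tabulate t)) * x
  sumℤ-count P? {zero}  t x = refl
  sumℤ-count P? {suc n} t x with P? (t zero)
  ... | yes _ = trans (cong (_+_ x) (sumℤ-count P? (t ∘ suc) x))
                      (sym (ℤ.suc-* (+ length (filter P? (tabulate (t ∘ suc)))) x))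
  ... | no  _ = trans (ℤ.+-identityˡ _) (sumℤ-count P? (t ∘ suc) x)

  module _ {n m} (o : Fin n → Fin m) (c : Fin m) where

    sumOrbit-cong : ∀ {g g′ : Fin n → ℤ} → (∀ j → o j ≡ c → g j ≡ g′ j) → sumOrbit o c g ≡ sumOrbit o c g′
    sumOrbit-cong {g} {g′} g≡g′ = sumℤ-cong pointwise
      where
      pointwise : ∀ j → (if ⌊ o j ≟ c ⌋ then g j else 0ℤ) ≡ (if ⌊ o j ≟ c ⌋ then g′ j else 0ℤ)
      pointwise j with o j ≟ c
      ... | yes oj≡c = g≡g′ j oj≡c
      ... | no  _    = refl

    sumOrbit-const : ∀ {g : Fin n → ℤ} x → (∀ j → o j ≡ c → g j ≡ x) → sumOrbit o c g ≡ + orbitSize o c * x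
    sumOrbit-const x g≡x = trans (sumOrbit-cong g≡x) (sumℤ-count (λ j → o j ≟ c) id x)

    sumOrbit-*ˡ : ∀ y (g : Fin n → ℤ) → sumOrbit o c (λ j → y * g j) ≡ y * sumOrbit o c g
    sumOrbit-*ˡ y g =
      trans (sumℤ-cong (λ j → if-*ˡ ⌊ o j ≟ c ⌋)) (sumℤ-*ˡ y (λ j → if ⌊ o j ≟ c ⌋ then g j else 0ℤ))
      where
      if-*ˡ : ∀ b {x} → (if b then y * x else 0ℤ) ≡ y * (if b then x else 0ℤ)
      if-*ˡ true  = refl
      if-*ˡ false = sym (ℤ.*-zeroʳ y)

  sumOrbit-comm : ∀ {p q a b} (o : Fin p → Fin a) (o′ : Fin q → Fin b) c c′ (G : Fin p → Fin q → ℤ) →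
                  sumOrbit o c (λ j → sumOrbit o′ c′ (G j)) ≡ sumOrbit o′ c′ (λ j′ → sumOrbit o c (λ j → G j j′))
  sumOrbit-comm o o′ c c′ G = begin
    sumOrbit o c (λ j → sumOrbit o′ c′ (G j))
      ≡⟨ sumℤ-cong (λ j → sumℤ-if ⌊ o j ≟ c ⌋ (λ j′ → if ⌊ o′ j′ ≟ c′ ⌋ then G j j′ else 0ℤ)) ⟩
    sumℤ (λ j → sumℤ (λ j′ → if ⌊ o j ≟ c ⌋ then (if ⌊ o′ j′ ≟ c′ ⌋ then G j j′ else 0ℤ) else 0ℤ))
      ≡⟨ sumℤ-comm (λ j j′ → if ⌊ o j ≟ c ⌋ then (if ⌊ o′ j′ ≟ c′ ⌋ then G j j′ else 0ℤ) else 0ℤ) ⟩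
    sumℤ (λ j′ → sumℤ (λ j → if ⌊ o j ≟ c ⌋ then (if ⌊ o′ j′ ≟ c′ ⌋ then G j j′ else 0ℤ) else 0ℤ))
      ≡⟨ sumℤ-cong (λ j′ → sumℤ-cong (λ j → if-swap-then ⌊ o j ≟ c ⌋ ⌊ o′ j′ ≟ c′ ⌋)) ⟩
    sumℤ (λ j′ → sumℤ (λ j → if ⌊ o′ j′ ≟ c′ ⌋ then (if ⌊ o j ≟ c ⌋ then G j j′ else 0ℤ) else 0ℤ))
      ≡⟨ sumℤ-cong (λ j′ → sumℤ-if ⌊ o′ j′ ≟ c′ ⌋ (λ j → if ⌊ o j ≟ c ⌋ then G j j′ else 0ℤ)) ⟨
    sumOrbit o′ c′ (λ j′ → sumOrbit o c (λ j → G j j′)) ∎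
    where open ≡-Reasoning

  sumℤ-fibres : ∀ {n m} (o : Fin n → Fin m) (h : Fin m → ℤ) (x : Fin n → ℤ) →
                sumℤ (λ l → h (o l) * x l) ≡ sumℤ (λ c → h c * sumOrbit o c x)
  sumℤ-fibres o h x = begin
    sumℤ (λ l → h (o l) * x l)
      ≡⟨ sumℤ-cong (λ l → sumℤ-δ (o l) (λ c → h c * x l)) ⟨
    sumℤ (λ l → sumℤ (λ c → if ⌊ o l ≟ c ⌋ then h c * x l else 0ℤ))
      ≡⟨ sumℤ-comm (λ l c → if ⌊ o l ≟ c ⌋ then h c * x l else 0ℤ) ⟩
    sumℤ (λ c → sumOrbit o c (λ l → h c * x l))
      ≡⟨ sumℤ-cong (λ c → sumOrbit-*ˡ o c (h c) x) ⟩
    sumℤ (λ c → h c * sumOrbit o c x) ∎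
    where open ≡-Reasoning

open Sums

module CorootAction {n} (a : Matrix n) where
  open import Data.Integer using (_+_)

  pairing : Vec n → Fin n → ℤ
  pairing h i = sumℤ (λ l → h l * a l i)

  sC-self : ∀ i (h : Vec n) → sC a i h i ≡ h i - pairing h i
  sC-self i h with i ≟ i
  ... | yes _   = refl
  ... | no  i≢i = contradiction refl i≢i

  sC-≢ : ∀ i {k} (h : Vec n) → k ≢ i → sC a i h k ≡ h k
  sC-≢ i {k} h k≢i with k ≟ i
  ... | yes k≡i = contradiction k≡i k≢i
  ... | no  _   = refl

  sC-cong : ∀ i {h h′ : Vec n} → h ≗ h′ → sC a i h ≗ sC a i h′
  sC-cong i h≗h′ k with ⌊ k ≟ i ⌋
  ... | true  = cong₂ _-_ (h≗h′ k) (sumℤ-cong (λ l → cong (_* a l i) (h≗h′ l)))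
  ... | false = h≗h′ k

  actC-cong : ∀ w {h h′ : Vec n} → h ≗ h′ → actC a w h ≗ actC a w h′
  actC-cong []      h≗h′ = h≗h′
  actC-cong (i ∷ w) h≗h′ = sC-cong i (actC-cong w h≗h′)

  actC-++ : ∀ w w′ (h : Vec n) → actC a (w ++ w′) h ≡ actC a w (actC a w′ h)
  actC-++ []      w′ h = refl
  actC-++ (i ∷ w) w′ h = cong (sC a i) (actC-++ w w′ h)

  pairing-+ : ∀ (h h′ : Vec n) i → pairing (λ k → h k + h′ k) i ≡ pairing h i + pairing h′ i
  pairing-+ h h′ i = trans (sumℤ-cong (λ l → ℤ.*-distribʳ-+ (a l i) (h l) (h′ l)))
                           (sumℤ-+ (λ l → h l * a l i) (λ l → h′ l * a l i))

  sC-+ : ∀ i (h h′ : Vec n) → sC a i (λ k → h k + h′ k) ≗ (λ k → sC a i h k + sC a i h′ k)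
  sC-+ i h h′ k with ⌊ k ≟ i ⌋
  ... | true  = trans (cong (λ p → h k + h′ k - p) (pairing-+ h h′ i))
                      (trans (cong (_+_ (h k + h′ k)) (ℤ.neg-distrib-+ (pairing h i) (pairing h′ i)))
                             (+-interchange (h k) (h′ k) _ _))
  ... | false = refl

  sC-0 : ∀ i → sC a i (λ _ → 0ℤ) ≗ (λ _ → 0ℤ)
  sC-0 i k with ⌊ k ≟ i ⌋
  ... | true  = cong (_-_ 0ℤ) (sumℤ-zero n)
  ... | false = refl

  actC-+ : ∀ w (h h′ : Vec n) → actC a w (λ k → h k + h′ k) ≗ (λ k → actC a w h k + actC a w h′ k)
  actC-+ []      h h′ k = refl
  actC-+ (i ∷ w) h h′ k = trans (sC-cong i (actC-+ w h h′) k) (sC-+ i (actC a w h) (actC a w h′) k)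

  actC-0 : ∀ w → actC a w (λ _ → 0ℤ) ≗ (λ _ → 0ℤ)
  actC-0 []      k = refl
  actC-0 (i ∷ w) k = trans (sC-cong i (actC-0 w) k) (sC-0 i k)

  actC-masked-sum : ∀ w {p} (b : Fin p → Bool) (G : Fin p → Vec n) k →
                    actC a w (λ k′ → sumℤ (λ j → if b j then G j k′ else 0ℤ)) k
                      ≡ sumℤ (λ j → if b j then actC a w (G j) k else 0ℤ)
  actC-masked-sum w {zero}  b G k = actC-0 w k
  actC-masked-sum w {suc p} b G k =
    trans (actC-+ w _ _ k) (cong₂ _+_ (actC-if (b zero)) (actC-masked-sum w (b ∘ suc) (G ∘ suc) k))
    where
    actC-if : ∀ c → actC a w (λ k′ → if c then G zero k′ else 0ℤ) k
                    ≡ (if c then actC a w (G zero) k else 0ℤ)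
    actC-if true  = refl
    actC-if false = actC-0 w k

  Orthogonal : List (Fin n) → Set
  Orthogonal L = ∀ {l j} → l ∈ L → j ∈ L → l ≢ j → a l j ≡ 0ℤ

  actC-∉ : ∀ {L k} (h : Vec n) → k ∉ L → actC a L h k ≡ h k
  actC-∉ {[]}    h k∉L = refl
  actC-∉ {j ∷ L} h k∉L = trans (sC-≢ j (actC a L h) (k∉L ∘ here)) (actC-∉ h (k∉L ∘ there))

  pairing-actC : ∀ L (h : Vec n) {j} → (∀ {l} → l ∈ L → a l j ≡ 0ℤ) → pairing (actC a L h) j ≡ pairing h j
  pairing-actC L h {j} a·j≡0 = sumℤ-cong term
    where
    term : ∀ l → actC a L h l * a l j ≡ h l * a l j
    term l with any? (l ≟_) L
    ... | yes l∈L rewrite a·j≡0 l∈L = trans (ℤ.*-zeroʳ (actC a L h l)) (sym (ℤ.*-zeroʳ (h l)))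
    ... | no  l∉L = cong (_* a l j) (actC-∉ h l∉L)

  actC-∈ : ∀ {L k} (h : Vec n) → Unique L → Orthogonal L → k ∈ L → actC a L h k ≡ h k - pairing h k
  actC-∈ {j ∷ L} h (j≢L ∷ _) orth (here refl) = begin
    sC a j (actC a L h) j                     ≡⟨ sC-self j (actC a L h) ⟩
    actC a L h j - pairing (actC a L h) j     ≡⟨ cong₂ _-_ (actC-∉ h j∉L) (pairing-actC L h a·j≡0) ⟩
    h j - pairing h j                         ∎
    where
    open ≡-Reasoning
    j∉L : j ∉ L
    j∉L = All¬⇒¬Any j≢L
    a·j≡0 : ∀ {l} → l ∈ L → a l j ≡ 0ℤ
    a·j≡0 l∈L = orth (there l∈L) (here refl) (λ l≡j → j∉L (subst (_∈ L) l≡j l∈L))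
  actC-∈ {j ∷ L} h (j≢L ∷ unique) orth (there k∈L) =
    trans (sC-≢ j (actC a L h) (λ k≡j → All¬⇒¬Any j≢L (subst (_∈ L) k≡j k∈L)))
          (actC-∈ h unique (λ l∈L j∈L → orth (there l∈L) (there j∈L)) k∈L)

open CorootAction

module FoldingCoroots {n m} (F : Folding n m) where
  open Folding F

  orb-π : ∀ l → orb (π ⟨$⟩ʳ l) ≡ orb l
  orb-π l = sym (Equivalence.from (orb-char l (π ⟨$⟩ʳ l)) (1 , refl))

  π-invariant⇒orbit-constant : ∀ {ℓ} {X : Set ℓ} (g : Fin n → X) → (∀ k → g (π ⟨$⟩ʳ k) ≡ g k) →
                               ∀ {k k′} → orb k ≡ orb k′ → g k ≡ g k′
  π-invariant⇒orbit-constant g g-π {k} {k′} same-orbit with Equivalence.to (orb-char k k′) same-orbit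
  ... | t , πᵗk≡k′ = trans (sym (g-iter t)) (cong g πᵗk≡k′)
    where
    g-iter : ∀ t → g (iter t π k) ≡ g k
    g-iter zero    = refl
    g-iter (suc t) = trans (g-π (iter t π k)) (g-iter t)

  sumOrbit-π : ∀ c (x : Fin n → ℤ) → sumOrbit orb c (x ∘ (π ⟨$⟩ʳ_)) ≡ sumOrbit orb c x
  sumOrbit-π c x = sym (trans (sumℤ-permute (λ l → if ⌊ orb l ≟ c ⌋ then x l else 0ℤ) π)
    (sumℤ-cong (λ l → cong (λ o → if ⌊ o ≟ c ⌋ then x (π ⟨$⟩ʳ l) else 0ℤ) (orb-π l))))

  column-constant : ∀ c {k k′} → orb k ≡ orb k′ → sumOrbit orb c (λ l → B l k) ≡ sumOrbit orb c (λ l → B l k′)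
  column-constant c = π-invariant⇒orbit-constant (λ k → sumOrbit orb c (λ l → B l k))
    (λ k → trans (sym (sumOrbit-π c (λ l → B l (π ⟨$⟩ʳ k)))) (sumOrbit-cong orb c (λ l _ → π-inv l k)))

  row-constant : ∀ c {j j′} → orb j ≡ orb j′ → sumOrbit orb c (B j) ≡ sumOrbit orb c (B j′)
  row-constant c = π-invariant⇒orbit-constant (λ j → sumOrbit orb c (B j))
    (λ j → trans (sym (sumOrbit-π c (B (π ⟨$⟩ʳ j)))) (sumOrbit-cong orb c (λ l _ → π-inv j l)))

  ∈-orbitList : ∀ {j i} → orb j ≡ i → j ∈ orbitList orb i
  ∈-orbitList {j} {i} = ∈-filter⁺ (λ l → orb l ≟ i) (∈-allFin j)

  orbitList-∈ : ∀ {j i} → j ∈ orbitList orb i → orb j ≡ i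
  orbitList-∈ {i = i} = proj₂ ∘ ∈-filter⁻ (λ l → orb l ≟ i) {xs = allFin n}

  orbitList-unique : ∀ i → Unique (orbitList orb i)
  orbitList-unique i = filter⁺ (λ l → orb l ≟ i) (allFin⁺ n)

  orbitList-orthogonal : ∀ i → Orthogonal B (orbitList orb i)
  orbitList-orthogonal i l∈Oᵢ j∈Oᵢ = admissible _ _ (trans (orbitList-∈ l∈Oᵢ) (sym (orbitList-∈ j∈Oᵢ)))

  orbitSize-nonZero : ∀ {k i} → orb k ≡ i → ℕ.NonZero (orbitSize orb i)
  orbitSize-nonZero k∈Oᵢ = >-nonZero (∈-length (∈-orbitList k∈Oᵢ))

  columnOrbitSum≡A : ∀ c {k i} → orb k ≡ i → sumOrbit orb c (λ l → B l k) ≡ A c i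
  columnOrbitSum≡A c {k} {i} k∈Oᵢ with orb-surj c
  ... | j′ , j′∈Oc = sym (ℤ.*-cancelˡ-≡ (+ orbitSize orb i) _ _ {{orbitSize-nonZero k∈Oᵢ}} (begin
    + orbitSize orb i * A c i
      ≡⟨ A-def c i j′ j′∈Oc ⟩
    + orbitSize orb c * sumOrbit orb i (B j′)
      ≡⟨ sumOrbit-const orb c _ (λ j j∈Oc → row-constant i (trans j∈Oc (sym j′∈Oc))) ⟨
    sumOrbit orb c (λ j → sumOrbit orb i (B j))
      ≡⟨ sumOrbit-comm orb orb c i B ⟩
    sumOrbit orb i (λ j → sumOrbit orb c (λ l → B l j))
      ≡⟨ sumOrbit-const orb i _ (λ j j∈Oᵢ → column-constant c (trans j∈Oᵢ (sym k∈Oᵢ))) ⟩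
    + orbitSize orb i * sumOrbit orb c (λ l → B l k) ∎))
    where open ≡-Reasoning

  pairing-∘orb : ∀ (h : Vec m) {k i} → orb k ≡ i → pairing B (h ∘ orb) k ≡ pairing A h i
  pairing-∘orb h {k} k∈Oᵢ =
    trans (sumℤ-fibres orb h (λ l → B l k)) (sumℤ-cong (λ c → cong (h c *_) (columnOrbitSum≡A c k∈Oᵢ)))

  actC-orbit : ∀ i (h : Vec m) → actC B (orbitList orb i) (h ∘ orb) ≗ sC A i h ∘ orb
  actC-orbit i h k with orb k ≟ i
  ... | yes k∈Oᵢ = begin
    actC B (orbitList orb i) (h ∘ orb) k
      ≡⟨ actC-∈ B (h ∘ orb) (orbitList-unique i) (orbitList-orthogonal i) (∈-orbitList k∈Oᵢ) ⟩
    h (orb k) - pairing B (h ∘ orb) k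
      ≡⟨ cong (_-_ (h (orb k))) (pairing-∘orb h k∈Oᵢ) ⟩
    h (orb k) - pairing A h i ∎
    where open ≡-Reasoning
  ... | no k∉Oᵢ = actC-∉ B (h ∘ orb) (k∉Oᵢ ∘ orbitList-∈)

  actC-fW : ∀ u (h : Vec m) → actC B (fW orb u) (h ∘ orb) ≗ actC A u h ∘ orb
  actC-fW []      h k = refl
  actC-fW (i ∷ u) h k = begin
    actC B (orbitList orb i ++ fW orb u) (h ∘ orb) k
      ≡⟨ cong-app (actC-++ B (orbitList orb i) (fW orb u) (h ∘ orb)) k ⟩
    actC B (orbitList orb i) (actC B (fW orb u) (h ∘ orb)) k
      ≡⟨ actC-cong B (orbitList orb i) (actC-fW u h) k ⟩
    actC B (orbitList orb i) (actC A u h ∘ orb) k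
      ≡⟨ actC-orbit i (actC A u h) k ⟩
    sC A i (actC A u h) (orb k) ∎
    where open ≡-Reasoning

  e∘orb : ∀ i → e i ∘ orb ≗ (λ k → sumOrbit orb i (λ j → e j k))
  e∘orb i k = sym (trans (sumℤ-cong (λ j → if-swap-then ⌊ orb j ≟ i ⌋ ⌊ k ≟ j ⌋)) (sumℤ-δ k (e i ∘ orb)))

  coroot-fold : ∀ u i j′ → coroot A u i (orb j′) ≡ sumOrbit orb i (λ j → coroot B (fW orb u) j j′)
  coroot-fold u i j′ = begin
    actC A u (e i) (orb j′)
      ≡⟨ actC-fW u (e i) j′ ⟨
    actC B (fW orb u) (e i ∘ orb) j′
      ≡⟨ actC-cong B (fW orb u) (e∘orb i) j′ ⟩
    actC B (fW orb u) (λ k → sumOrbit orb i (λ j → e j k)) j′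
      ≡⟨ actC-masked-sum B (fW orb u) (λ j → ⌊ orb j ≟ i ⌋) e j′ ⟩
    sumOrbit orb i (λ j → actC B (fW orb u) (e j) j′) ∎
    where open ≡-Reasoning

open FoldingCoroots using (coroot-fold)
open import Data.Nat using (_+_)

proposition4p7 : ∀ {n m} (F : Folding n m) (i' : Fin m) (j' : Fin n) →
    Folding.orb F j' ≡ i' →
    (v w u u₁ : Word m) (i : Fin m) →
    BruhatCover (Folding.A F) v w u i →
    w ≈[ Folding.A F ] (u₁ ++ i ∷ reverse u) →
    v ≈[ Folding.A F ] (u₁ ++ reverse u) →
    (Σ ℕ λ l₁ → Σ ℕ λ l₂ → IsLength (Folding.A F) u₁ l₁ × IsLength (Folding.A F) (reverse u) l₂
        × IsLength (Folding.A F) w (l₁ + suc l₂)) →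
    (mult (Folding.A F) i' v w u i
       ≡ sumOrbit (Folding.orb F) i (λ j → mult (Folding.B F) j'
           (fW (Folding.orb F) w ++ reflection (fW (Folding.orb F) u) j) (fW (Folding.orb F) w)
           (fW (Folding.orb F) u) j))
    × (sumOrbit (Folding.orb F) i (λ j → mult (Folding.B F) j'
           (fW (Folding.orb F) w ++ reflection (fW (Folding.orb F) u) j) (fW (Folding.orb F) w)
           (fW (Folding.orb F) u) j)
       ≡ sumOrbit (Folding.orb F) i (λ j → mult (Folding.B F) j'
           (fW (Folding.orb F) v) (fW (Folding.orb F) v ++ reflection (fW (Folding.orb F) u) j)
           (fW (Folding.orb F) u) j))
proposition4p7 F i' j' j'∈Oᵢ' v w u u₁ i _ _ _ _ =
  subst (λ c → coroot (Folding.A F) u i c ≡ _) j'∈Oᵢ' (coroot-fold F u i j') , refl
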